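{- Let $n=2^s\prod_{i=1}^k q_i^{\alpha_i}$ with $s\ge 1$, $k\ge 0$, $q_1,\dots,q_k$ distinct odd primes and $\alpha_i\ge 1$, and let $z=2\prod_{i=1}^k q_i$. Then $|A(n)|=\frac{n}{z}\,|A(z)|$.
   Context: For an integer $m>0$, $A(m)=\{x\in\mathbb{Z}: 0<x<m,\ \gcd(x,m)=1,\ \gcd(x-2,m)>1,\ \gcd(x+2,m)>1\}$. -}

module Defs where

open import Data.Nat using (ℕ; zero; suc; _+_; _*_; _^_; _<_; _≤_; ∣_-_∣; NonZero)
open import Data.Nat.GCD using (gcd)
open import Data.Nat.Properties using (_≟_; _<?_)
open import Data.List using (List; filter; upTo; length)
open import Data.Product using (_×_; _,_; proj₁; proj₂)
open import Relation.Nullary using (Dec; ¬_)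
open import Relation.Nullary.Decidable using (_×-dec_)

-- Membership condition of A(m) for 0 < x < m:
--   gcd(x,m) = 1, gcd(x-2,m) > 1, gcd(x+2,m) > 1.
-- Here gcd(x-2,m) for an integer x-2 equals gcd(|x-2|,m), computed via ∣ x - 2 ∣.
InA : ℕ → ℕ → Set
InA m x = (gcd x m ≡ 1) × (1 < gcd ∣ x - 2 ∣ m) × (1 < gcd (x + 2) m)
  where open import Relation.Binary.PropositionalEquality using (_≡_)

InA? : (m x : ℕ) → Dec (InA m x)
InA? m x = (gcd x m ≟ 1) ×-dec ((1 <? gcd ∣ x - 2 ∣ m) ×-dec (1 <? gcd (x + 2) m))

A : ℕ → List ℕ
A m = filter (λ x → (0 <? x) ×-dec InA? m x) (upTo m)

card-A : ℕ → ℕ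
card-A m = length (A m)

-- Membership of x in A(m) only depends on which of x, |x - 2| and x + 2 are coprime to m,
-- and an integer is coprime to n iff it is coprime to z, as n and z have the same prime
-- divisors.  So A(n) consists of the x in [1, n) satisfying the conditions that define A(z).
-- These conditions only depend on x modulo z, and [0, n) consists of n / z periods.
module Submission where

open import Defs
open import Data.Nat using (ℕ; _*_; _^_; _≤_; _/_; NonZero)
open import Data.Nat.Primality using (Prime)
open import Data.Nat.Divisibility using (_∣_)
open import Data.List using (List; map)
open import Data.Nat.ListAction using (product)
open import Data.List.Relation.Unary.All using (All)
open import Data.List.Relation.Unary.Unique.Propositional using (Unique)
open import Data.Product using (_×_; _,_; proj₁; proj₂)
open import Relation.Nullary using (¬_)
open import Relation.Binary.PropositionalEquality using (_≡_)

open import Level using (Level; 0ℓ)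
open import Function using (_∘_; id)
open import Data.Bool using (true; false)
open import Data.Nat using (zero; suc; _+_; _<_; ∣_-_∣; z<s; s<s; s≤s; ≢-nonZero⁻¹; >-nonZero⁻¹)
open import Data.Nat.Properties
  using (+-comm; +-assoc; +-identityʳ; +-suc; *-monoʳ-≤; <⇒≢; m*n≢0; m*n≢0⇒n≢0; ∣-∣-identityʳ)
open import Data.Nat.Divisibility using (divides; ∣-refl; ∣-trans; *-pres-∣; m∣m*n; n∣m*n)
open import Data.Nat.DivMod using (m*n/n≡m; 0/n≡0)
open import Data.Nat.GCD using (gcd; gcd-GCD; module GCD; gcd-comm; gcd-identityˡ; gcd[m,n]≡0⇒n≡0)
open import Data.Nat.Coprimality
  using (Coprime; coprime⇒gcd≡1; gcd≡1⇒coprime; coprime-divisor; 1-coprimeTo)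
  renaming (sym to coprime-sym)
open import Data.List using ([]; _∷_; _++_; filter; length; applyUpTo; upTo)
open import Data.List.Properties using (filter-++; filter-≐; length-++; length-map; map-upTo)
open import Data.List.Relation.Unary.All using ([]; _∷_)
import Data.List.Relation.Unary.All as All
open import Data.Empty using (⊥-elim)
open import Relation.Nullary using (does; contradiction)
open import Relation.Unary using (Pred; Decidable; _⊆_; _≐_)
open import Relation.Unary.Properties using (≐-refl; ≐-sym)
open import Relation.Binary.PropositionalEquality using (refl; sym; trans; cong; cong₂; subst; module ≡-Reasoning)

private variable
  a b p : Level
  X : Set a
  Y : Set b

≡⇒≐ : {P Q : Pred X p} → (∀ x → P x ≡ Q x) → P ≐ Q
≡⇒≐ P≡Q = (λ {x} → subst id (P≡Q x)) , (λ {x} → subst id (sym (P≡Q x)))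

filter-map : {P : Pred Y p} (P? : Decidable P) (f : X → Y) (xs : List X) →
             filter P? (map f xs) ≡ map f (filter (P? ∘ f) xs)
filter-map P? f [] = refl
filter-map P? f (x ∷ xs) with does (P? (f x))
... | true  = cong (f x ∷_) (filter-map P? f xs)
... | false = filter-map P? f xs

length-filter-map-≐ : {P : Pred X p} (P? : Decidable P) {f : X → X} → (P ∘ f) ≐ P →
                      ∀ xs → length (filter P? (map f xs)) ≡ length (filter P? xs)
length-filter-map-≐ P? {f} Pf≐P xs = begin
  length (filter P? (map f xs))        ≡⟨ cong length (filter-map P? f xs) ⟩
  length (map f (filter (P? ∘ f) xs))  ≡⟨ length-map f (filter (P? ∘ f) xs) ⟩
  length (filter (P? ∘ f) xs)          ≡⟨ cong length (filter-≐ (P? ∘ f) P? Pf≐P xs) ⟩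
  length (filter P? xs)                ∎
  where open ≡-Reasoning

applyUpTo-+ : ∀ (f : ℕ → X) m n → applyUpTo f (m + n) ≡ applyUpTo f m ++ applyUpTo (f ∘ (m +_)) n
applyUpTo-+ f zero    n = refl
applyUpTo-+ f (suc m) n = cong (f 0 ∷_) (applyUpTo-+ (f ∘ suc) m n)

upTo-+ : ∀ m n → upTo (m + n) ≡ upTo m ++ map (m +_) (upTo n)
upTo-+ m n = trans (applyUpTo-+ id m n) (cong (upTo m ++_) (sym (map-upTo (m +_) n)))

length-filter-upTo-periodic : {P : Pred ℕ p} (P? : Decidable P) (z : ℕ) → (P ∘ (z +_)) ≐ P →
  ∀ k → length (filter P? (upTo (k * z))) ≡ k * length (filter P? (upTo z))
length-filter-upTo-periodic P? z periodic zero    = refl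
length-filter-upTo-periodic P? z periodic (suc k) = begin
  length (filter P? (upTo (z + k * z)))
    ≡⟨ cong (length ∘ filter P?) (upTo-+ z (k * z)) ⟩
  length (filter P? (upTo z ++ map (z +_) (upTo (k * z))))
    ≡⟨ cong length (filter-++ P? (upTo z) (map (z +_) (upTo (k * z)))) ⟩
  length (filter P? (upTo z) ++ filter P? (map (z +_) (upTo (k * z))))
    ≡⟨ length-++ (filter P? (upTo z)) ⟩
  period + length (filter P? (map (z +_) (upTo (k * z))))
    ≡⟨ cong (period +_) (length-filter-map-≐ P? periodic (upTo (k * z))) ⟩
  period + length (filter P? (upTo (k * z)))
    ≡⟨ cong (period +_) (length-filter-upTo-periodic P? z periodic k) ⟩
  period + k * period
    ∎
  where
  open ≡-Reasoning
  period = length (filter P? (upTo z))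

gcd[m,m+n]≡gcd[m,n] : ∀ m n → gcd m (m + n) ≡ gcd m n
gcd[m,m+n]≡gcd[m,n] m n = GCD.unique (gcd-GCD m (m + n)) (GCD.step (gcd-GCD m n))

gcd[m+n,m]≡gcd[n,m] : ∀ m n → gcd (m + n) m ≡ gcd n m
gcd[m+n,m]≡gcd[n,m] m n = begin
  gcd (m + n) m  ≡⟨ gcd-comm (m + n) m ⟩
  gcd m (m + n)  ≡⟨ gcd[m,m+n]≡gcd[m,n] m n ⟩
  gcd m n        ≡⟨ gcd-comm m n ⟩
  gcd n m        ∎
  where open ≡-Reasoning

gcd-complement : ∀ m k {n} → m + k ≡ n → gcd m n ≡ gcd k n
gcd-complement m k refl = begin
  gcd m (m + k)  ≡⟨ gcd[m,m+n]≡gcd[m,n] m k ⟩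
  gcd m k        ≡⟨ gcd-comm m k ⟩
  gcd k m        ≡⟨ gcd[m,m+n]≡gcd[m,n] k m ⟨
  gcd k (k + m)  ≡⟨ cong (gcd k) (+-comm k m) ⟩
  gcd k (m + k)  ∎
  where open ≡-Reasoning

-- For x < 2 the residues of z + x - 2 and x - 2 are negatives of each other.
gcd∣z+x-2∣≡gcd∣x-2∣ : ∀ {z} → 2 ≤ z → ∀ x → gcd ∣ z + x - 2 ∣ z ≡ gcd ∣ x - 2 ∣ z
gcd∣z+x-2∣≡gcd∣x-2∣ {suc zero}    (s≤s ())
gcd∣z+x-2∣≡gcd∣x-2∣ {suc (suc w)} _ x rewrite ∣-∣-identityʳ (w + x) = shifted x
  where
  shifted : ∀ x → gcd (w + x) (2 + w) ≡ gcd ∣ x - 2 ∣ (2 + w)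
  shifted zero          = gcd-complement (w + 0) 2 (trans (+-comm (w + 0) 2) (cong (2 +_) (+-identityʳ w)))
  shifted (suc zero)    = gcd-complement (w + 1) 1 (trans (+-comm (w + 1) 1) (cong suc (+-comm w 1)))
  shifted (suc (suc y)) rewrite ∣-∣-identityʳ y | +-suc w (suc y) | +-suc w y =
    gcd[m+n,m]≡gcd[n,m] (2 + w) y

coprime-∣ˡ : ∀ {d y m} → d ∣ y → Coprime y m → Coprime d m
coprime-∣ˡ d∣y y⊥m (e∣d , e∣m) = y⊥m (∣-trans e∣d d∣y , e∣m)

coprime-∣ʳ : ∀ {y m n} → m ∣ n → Coprime y n → Coprime y m
coprime-∣ʳ m∣n y⊥n (e∣y , e∣m) = y⊥n (e∣y , ∣-trans e∣m m∣n)

coprime-* : ∀ {y m n} → Coprime y m → Coprime y n → Coprime y (m * n)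
coprime-* y⊥m y⊥n (d∣y , d∣m*n) = y⊥n (d∣y , coprime-divisor (coprime-∣ˡ d∣y y⊥m) d∣m*n)

coprime-^ : ∀ {y m} → Coprime y m → ∀ k → Coprime y (m ^ k)
coprime-^ {y} y⊥m zero    = coprime-sym (1-coprimeTo y)
coprime-^     y⊥m (suc k) = coprime-* y⊥m (coprime-^ y⊥m k)

1<gcd⇒¬coprime : ∀ {y m} → 1 < gcd y m → ¬ Coprime y m
1<gcd⇒¬coprime 1<gcd coprime = <⇒≢ 1<gcd (sym (coprime⇒gcd≡1 coprime))

¬coprime⇒1<gcd : ∀ {y m} → .{{NonZero m}} → ¬ Coprime y m → 1 < gcd y m
¬coprime⇒1<gcd {y} {m} ¬coprime with gcd y m in eq
... | zero        = contradiction (gcd[m,n]≡0⇒n≡0 y eq) (≢-nonZero⁻¹ m)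
... | suc zero    = ⊥-elim (¬coprime (gcd≡1⇒coprime eq))
... | suc (suc _) = s<s z<s

CoprimeTo : ℕ → Pred ℕ 0ℓ
CoprimeTo m y = Coprime y m

powerProduct : List (ℕ × ℕ) → ℕ
powerProduct qas = product (map (λ p → proj₁ p ^ proj₂ p) qas)

baseProduct : List (ℕ × ℕ) → ℕ
baseProduct qas = product (map proj₁ qas)

coprime-powerProduct : ∀ {y} qas → Coprime y (baseProduct qas) → Coprime y (powerProduct qas)
coprime-powerProduct {y} []              _ = coprime-sym (1-coprimeTo y)
coprime-powerProduct     ((q , α) ∷ qas) y⊥qB =
  coprime-* (coprime-^ (coprime-∣ʳ (m∣m*n (baseProduct qas)) y⊥qB) α)
            (coprime-powerProduct qas (coprime-∣ʳ (n∣m*n q) y⊥qB))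

baseProduct∣powerProduct : ∀ {qas} → All ((1 ≤_) ∘ proj₂) qas → baseProduct qas ∣ powerProduct qas
baseProduct∣powerProduct {[]}               []      = ∣-refl
baseProduct∣powerProduct {(q , suc α) ∷ _} (_ ∷ αs) = *-pres-∣ (m∣m*n {q} (q ^ α)) (baseProduct∣powerProduct αs)

coprimeTo-powerProduct≐baseProduct : ∀ {qas} → All ((1 ≤_) ∘ proj₂) qas →
                                     CoprimeTo (powerProduct qas) ≐ CoprimeTo (baseProduct qas)
coprimeTo-powerProduct≐baseProduct {qas} αs =
  coprime-∣ʳ (baseProduct∣powerProduct αs) , coprime-powerProduct qas

InA-periodic : ∀ {z} → 2 ≤ z → (InA z ∘ (z +_)) ≐ InA z
InA-periodic {z} 2≤z = ≡⇒≐ λ x →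
  cong₂ _×_ (cong (_≡ 1) (gcd[m+n,m]≡gcd[n,m] z x))
    (cong₂ _×_ (cong (1 <_) (gcd∣z+x-2∣≡gcd∣x-2∣ 2≤z x))
      (cong (1 <_) (trans (cong (λ t → gcd t z) (+-assoc z x 2)) (gcd[m+n,m]≡gcd[n,m] z (x + 2)))))

InA⇒0<x : ∀ {z x} → 2 ≤ z → InA z x → 0 < x
InA⇒0<x {z} {zero}  2≤z (gcd[0,z]≡1 , _) = contradiction (trans (sym gcd[0,z]≡1) (gcd-identityˡ z)) (<⇒≢ 2≤z)
InA⇒0<x {z} {suc _} _   _                = z<s

InA-⊆ : ∀ {m n} → .{{NonZero n}} → CoprimeTo m ≐ CoprimeTo n → InA m ⊆ InA n
InA-⊆ {m} {n} (m⊆n , n⊆m) {x} (gcd≡1 , 1<gcd₋ , 1<gcd₊) =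
  coprime⇒gcd≡1 (m⊆n {x} (gcd≡1⇒coprime gcd≡1)) , shareFactor {∣ x - 2 ∣} 1<gcd₋ , shareFactor {x + 2} 1<gcd₊
  where
  shareFactor : ∀ {y} → 1 < gcd y m → 1 < gcd y n
  shareFactor {y} 1<gcd = ¬coprime⇒1<gcd (1<gcd⇒¬coprime 1<gcd ∘ n⊆m {y})

InA-≐ : ∀ {m n} → .{{NonZero m}} → .{{NonZero n}} → CoprimeTo m ≐ CoprimeTo n → InA m ≐ InA n
InA-≐ m≐n = (λ {x} → InA-⊆ m≐n {x}) , (λ {x} → InA-⊆ (≐-sym m≐n) {x})

positive∩InA≐InA : ∀ {m z} → 2 ≤ z → InA m ≐ InA z → (λ x → 0 < x × InA m x) ≐ InA z
positive∩InA≐InA 2≤z (m⊆z , z⊆m) =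
  (λ {x} (_ , inA) → m⊆z {x} inA) , (λ {x} inA → InA⇒0<x {x = x} 2≤z inA , z⊆m {x} inA)

card-A-multiple : ∀ n z .{{_ : NonZero z}} → 2 ≤ z → z ∣ n → CoprimeTo n ≐ CoprimeTo z →
                  card-A n ≡ (n / z) * card-A z
card-A-multiple _ z _   (divides zero refl) _ = cong (_* card-A z) (sym (0/n≡0 z))
card-A-multiple _ z 2≤z (divides k@(suc _) refl) n≐z = begin
  card-A (k * z)
    ≡⟨ cong length (filter-≐ _ (InA? z) (positive∩InA≐InA 2≤z (InA-≐ {{m*n≢0 k z}} n≐z)) (upTo (k * z))) ⟩
  length (filter (InA? z) (upTo (k * z)))
    ≡⟨ length-filter-upTo-periodic (InA? z) z (InA-periodic 2≤z) k ⟩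
  k * length (filter (InA? z) (upTo z))
    ≡⟨ cong (λ c → k * length c) (filter-≐ (InA? z) _ (≐-sym (positive∩InA≐InA 2≤z ≐-refl)) (upTo z)) ⟩
  k * card-A z
    ≡⟨ cong (_* card-A z) (m*n/n≡m k z) ⟨
  (k * z / z) * card-A z
    ∎
  where open ≡-Reasoning

lemma3 : (s : ℕ) → 1 ≤ s → (qas : List (ℕ × ℕ)) →
    All (λ p → Prime (proj₁ p) × ¬ (2 ∣ proj₁ p) × 1 ≤ proj₂ p) qas →
    Unique (map proj₁ qas) →
    (n z : ℕ) → .{{_ : NonZero z}} →
    n ≡ 2 ^ s * product (map (λ p → proj₁ p ^ proj₂ p) qas) →
    z ≡ 2 * product (map proj₁ qas) →
    card-A n ≡ (n / z) * card-A z
lemma3 s 1≤s qas conditions _ _ _ refl refl =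
  card-A-multiple (powerProduct ((2 , s) ∷ qas)) (baseProduct ((2 , s) ∷ qas)) 2≤z
    (baseProduct∣powerProduct exponents≥1) (coprimeTo-powerProduct≐baseProduct exponents≥1)
  where
  exponents≥1 : All ((1 ≤_) ∘ proj₂) ((2 , s) ∷ qas)
  exponents≥1 = 1≤s ∷ All.map (proj₂ ∘ proj₂) conditions

  2≤z : 2 ≤ 2 * baseProduct qas
  2≤z = *-monoʳ-≤ 2 (>-nonZero⁻¹ (baseProduct qas) {{m*n≢0⇒n≢0 2}})
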